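{- Let $p$ be a prime, $n$ a positive integer (with $n\ge2$ if $p=2$), $k$ a positive integer, and $G=\mathbb{Z}/p^n\mathbb{Z}$ with generator $\sigma$. Let $W$ be an $\mathbb{F}_p[G]$-module which properly contains a submodule $V \simeq \mathbb{F}_p[G]^k$, and suppose there exists $\delta \in W$ with $(\sigma-1)^{p^n-1}\delta = 0$ and $\delta \notin V$. Then $W$ contains at least $p^k$ distinct submodules isomorphic to $\mathbb{F}_p[G]^k$. -}

module Defs where

open import Level using (0ℓ)
open import Data.Nat using (ℕ; zero; suc; _^_)
open import Data.Nat.DivMod using (_mod_)
open import Data.Fin using (Fin; toℕ)
open import Data.Vec using (Vec; []; _∷_; last; init; zipWith; map; replicate)
open import Data.Product using (Σ; _×_; ∃)
open import Function using (_∘_)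
open import Relation.Nullary using (¬_)
open import Relation.Binary.PropositionalEquality using (_≡_)
open import Algebra.Structures using (IsAbelianGroup)

iter : ∀ {A : Set} → ℕ → (A → A) → A → A
iter zero    f x = x
iter (suc m) f x = f (iter m f x)

-- An F_p[G]-module is an abelian group W of exponent p (i.e. an F_p-vector
-- space; F_p-scalar multiplication is then determined by addition), together
-- with the action of the generator σ by an additive map with σ^(p^n) = id
-- (so G acts by additive, hence F_p-linear, automorphisms).

record FpGModule (p n : ℕ) : Set₁ where
  field
    Carrier : Set
    _+_     : Carrier → Carrier → Carrier
    0#      : Carrier
    -_      : Carrier → Carrier
    isAbelianGroup : IsAbelianGroup _≡_ _+_ 0# -_
    char-p  : ∀ w → iter p (w +_) 0# ≡ 0#
    σ       : Carrier → Carrier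
    σ-+     : ∀ v w → σ (v + w) ≡ σ v + σ w
    σ-order : ∀ w → iter (p ^ n) σ w ≡ w

  σ-1 : Carrier → Carrier
  σ-1 w = σ w + (- w)

  record IsSubmodule (S : Carrier → Set) : Set where
    field
      0∈  : S 0#
      +∈  : ∀ {v w} → S v → S w → S (v + w)
      -∈  : ∀ {v} → S v → S (- v)
      σ∈  : ∀ {v} → S v → S (σ v)

  SameSubset : (S T : Carrier → Set) → Set
  SameSubset S T = (∀ w → S w → T w) × (∀ w → T w → S w)

-- F_p = Fin p with addition mod p.  An element of F_p[G] is its coefficient
-- vector (a_0, …, a_{p^n - 1}) standing for Σ a_i σ^i; multiplication by σ
-- shifts coefficients cyclically: a_i ↦ coefficient of σ^(i+1).

_+p_ : ∀ {p} → Fin p → Fin p → Fin p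
_+p_ {suc q} a b = (toℕ a Data.Nat.+ toℕ b) mod suc q

rotate : ∀ {A : Set} {m} → Vec A m → Vec A m
rotate []       = []
rotate (x ∷ xs) = last (x ∷ xs) ∷ init (x ∷ xs)

FpG : ℕ → ℕ → Set
FpG p n = Vec (Fin p) (p ^ n)

FpG^ : ℕ → ℕ → ℕ → Set
FpG^ p n k = Vec (FpG p n) k

addFree : ∀ p n k → FpG^ p n k → FpG^ p n k → FpG^ p n k
addFree p n k = zipWith (zipWith _+p_)

σFree : ∀ p n k → FpG^ p n k → FpG^ p n k
σFree p n k = map rotate

-- A submodule S of W is isomorphic to F_p[G]^k: there is an injective
-- F_p[G]-module homomorphism F_p[G]^k → W (additive and σ-equivariant, hence
-- F_p[G]-linear) whose image is exactly S.
module _ {p n : ℕ} (W : FpGModule p n) where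
  open FpGModule W

  IsoToFree : ℕ → (Carrier → Set) → Set
  IsoToFree k S =
    Σ (FpG^ p n k → Carrier) λ φ →
      (∀ x y → φ (addFree p n k x y) ≡ φ x + φ y) ×
      (∀ x → φ (σFree p n k x) ≡ σ (φ x)) ×
      (∀ x y → φ x ≡ φ y → x ≡ y) ×
      (∀ w → S w → ∃ λ x → φ x ≡ w) ×
      (∀ x → S (φ x))

module Submission where

-- Let G = ⟨σ⟩ have order m = p^n, V ≅ F_p[G]^k via φ, and δ ∉ V
-- with (σ-1)^(m-1) δ = 0.  For a ∈ F_p^k put f_a(x) = φ(x) + Σ_i a_i x_i δ.
-- The key fact is an identity for any additive s in characteristic p,
--   (s - 1)^(p^e - 1) = 1 + s + ⋯ + s^(p^e - 1),
-- from the binomial theorem for s = (s - 1) + 1 and p ∣ C(p,j).  For s = σ it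
-- gives N δ = 0 (N the norm of G) and nilpotence of σ - 1.  Then f_a is
-- injective (descend through the kernels of (σ-1)^j: a σ-fixed y has constant
-- slots, so Σ a_i y_i δ is a multiple of N δ = 0), and U_a = im f_a ⊆ U_b
-- forces a = b (applying N to f_b(x) = f_a(e_l), x and e_l have equal slot
-- augmentations, so modulo V, (σ-1)^j of that equation gives (b_l - a_l)
-- (σ-1)^j δ ∈ V once (σ-1)^(j+1) δ ∈ V; descending, δ ∈ V).

open import Defs
open import Level using (0ℓ)
open import Algebra.Bundles using (AbelianGroup)
open import Algebra.Structures using (IsAbelianGroup)
open import Data.Empty using (⊥-elim)
open import Data.Fin using (Fin; zero; suc; toℕ; inject₁; fromℕ; fromℕ<; combine; finToFun; funToFin)
open import Data.Fin.Properties using (toℕ-fromℕ<; toℕ<n; toℕ-injective; funToFin-finToFin; ¬∀⟶∃¬; _≟_)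
open import Data.Nat as ℕ using (ℕ; zero; suc; _^_; _∸_; _≤_; _<_; z≤n; s≤s)
import Data.Nat.Properties as ℕP
open import Algebra.Properties.CommutativeMonoid.Sum ℕP.+-0-commutativeMonoid
  using (sum; sum-cong-≗; sum-init-last; ∑-distrib-+; sum-replicate-zero)
open import Data.Nat.Coprimality using (Coprime; coprime-Bézout)
open import Data.Nat.Divisibility using (_∣_; divides; n∣m⇒m%n≡0; ∣⇒≤)
open import Data.Nat.DivMod
  using (_%_; _/_; m≡m%n+[m/n]*n; %-distribˡ-+; m%n%n≡m%n; m<n⇒m%n≡m; [m+kn]%n≡m%n)
open import Data.Nat.GCD using (module Bézout)
open import Data.Nat.Primality using (Prime; euclidsLemma; prime⇒irreducible; ¬prime[0]; ¬prime[1])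
open import Data.Nat.Solver using (module +-*-Solver)
open import Data.Product using (Σ; ∃; _×_; _,_; proj₁; proj₂)
open import Data.Sum using (inj₁; inj₂)
open import Data.Vec using (Vec; []; _∷_; lookup; replicate; zipWith; map; init; last; _∷ʳ_; initLast; tabulate)
open import Data.Vec.Properties
  using (lookup-zipWith; lookup-replicate; lookup-map; ∷-injective; zipWith-replicate; lookup∘tabulate)
open import Function using (_∘_)
open import Relation.Nullary using (¬_)
open import Relation.Binary.PropositionalEquality
open ≡-Reasoning

iter-suc : ∀ {A : Set} m (f : A → A) x → iter m f (f x) ≡ iter (suc m) f x
iter-suc zero    f x = refl
iter-suc (suc m) f x = cong f (iter-suc m f x)

iter-+ : ∀ {A : Set} a b (f : A → A) x → iter (a ℕ.+ b) f x ≡ iter a f (iter b f x)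
iter-+ zero    b f x = refl
iter-+ (suc a) b f x = cong f (iter-+ a b f x)

iter-* : ∀ {A : Set} a b (f : A → A) x → iter (a ℕ.* b) f x ≡ iter a (iter b f) x
iter-* zero    b f x = refl
iter-* (suc a) b f x = trans (iter-+ b (a ℕ.* b) f x) (cong (iter b f) (iter-* a b f x))

iter-cong : ∀ {A : Set} a {f g : A → A} → (∀ x → f x ≡ g x) → ∀ x → iter a f x ≡ iter a g x
iter-cong zero    f≗g x = refl
iter-cong (suc a) {f} f≗g x = trans (cong f (iter-cong a f≗g x)) (f≗g _)

iter-natural : ∀ {A B : Set} {f : A → A} {g : B → B} (h : A → B) →
               (∀ x → h (f x) ≡ g (h x)) → ∀ m x → h (iter m f x) ≡ iter m g (h x)
iter-natural h hf zero    x = refl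
iter-natural {g = g} h hf (suc m) x = trans (hf _) (cong g (iter-natural h hf m x))

descend : ∀ {Q : ℕ → Set} → (∀ j → Q (suc j) → Q j) → ∀ M → Q M → Q 0
descend step zero    q = q
descend step (suc M) q = descend step M (step M q)

choose : ℕ → ℕ → ℕ
choose _       zero    = 1
choose zero    (suc k) = 0
choose (suc n) (suc k) = choose n k ℕ.+ choose n (suc k)

choose-> : ∀ {n k} → n < k → choose n k ≡ 0
choose-> {zero}  {suc k} _         = refl
choose-> {suc n} {suc k} (s≤s n<k) =
  cong₂ ℕ._+_ (choose-> n<k) (choose-> (ℕP.m<n⇒m<1+n n<k))

choose-diag : ∀ n → choose n n ≡ 1
choose-diag zero    = refl
choose-diag (suc n) = cong₂ ℕ._+_ (choose-diag n) (choose-> (ℕP.n<1+n n))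

choose-1 : ∀ n → choose n 1 ≡ n
choose-1 zero    = refl
choose-1 (suc n) = cong suc (choose-1 n)

choose-absorb : ∀ n k → suc k ℕ.* choose (suc n) (suc k) ≡ suc n ℕ.* choose n k
choose-absorb zero    zero    = refl
choose-absorb zero    (suc k) = ℕP.*-zeroʳ (suc (suc k))
choose-absorb (suc n) zero    =
  trans (ℕP.*-identityˡ _) (trans (cong suc (choose-1 (suc n))) (sym (ℕP.*-identityʳ _)))
choose-absorb (suc n) (suc k) = begin
    suc (suc k) ℕ.* (choose (suc n) (suc k) ℕ.+ choose (suc n) (suc (suc k)))
  ≡⟨ ℕP.*-distribˡ-+ (suc (suc k)) (choose (suc n) (suc k)) _ ⟩
    suc (suc k) ℕ.* choose (suc n) (suc k) ℕ.+ suc (suc k) ℕ.* choose (suc n) (suc (suc k))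
  ≡⟨ cong₂ ℕ._+_ (cong (choose (suc n) (suc k) ℕ.+_) (choose-absorb n k)) (choose-absorb n (suc k)) ⟩
    (choose (suc n) (suc k) ℕ.+ suc n ℕ.* choose n k) ℕ.+ suc n ℕ.* choose n (suc k)
  ≡⟨ ℕP.+-assoc (choose (suc n) (suc k)) _ _ ⟩
    choose (suc n) (suc k) ℕ.+ (suc n ℕ.* choose n k ℕ.+ suc n ℕ.* choose n (suc k))
  ≡⟨ cong (choose (suc n) (suc k) ℕ.+_) (sym (ℕP.*-distribˡ-+ (suc n) (choose n k) _)) ⟩
    suc (suc n) ℕ.* choose (suc n) (suc k)
  ∎

prime∣choose : ∀ {P} → Prime (suc P) → ∀ {i} → i < P → suc P ∣ choose (suc P) (suc i)
prime∣choose {P} p-prime {i} i<P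
  with euclidsLemma (suc i) (choose (suc P) (suc i)) p-prime
         (divides (choose P i) (trans (choose-absorb P i) (ℕP.*-comm (suc P) (choose P i))))
... | inj₂ p∣C   = p∣C
... | inj₁ p∣1+i = ⊥-elim (ℕP.<⇒≱ (s≤s i<P) (∣⇒≤ p∣1+i))

module AbelianGroupFacts {C : Set} {_+_ : C → C → C} {0# : C} { -_ : C → C }
                         (isAbelianGroup : IsAbelianGroup _≡_ _+_ 0# -_) where

  abelianGroup : AbelianGroup 0ℓ 0ℓ
  abelianGroup = record
    { Carrier = C; _≈_ = _≡_; _∙_ = _+_; ε = 0#; _⁻¹ = -_; isAbelianGroup = isAbelianGroup }

  open AbelianGroup abelianGroup public using () renaming (_∙_ to infixl 6 _⊕_; _⁻¹ to infix 8 ⊖_)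

  open IsAbelianGroup isAbelianGroup public
    using (assoc; comm; identityˡ; identityʳ; inverseˡ; inverseʳ)
  open import Algebra.Properties.AbelianGroup abelianGroup public
    using (identityʳ-unique; inverseʳ-unique; ⁻¹-involutive; ⁻¹-∙-comm; x∙y⁻¹≈ε⇒x≈y; x≈z//y)
  open import Algebra.Properties.CommutativeSemigroup (AbelianGroup.commutativeSemigroup abelianGroup) public
    using (interchange; x∙yz≈y∙xz)
  open import Algebra.Properties.CommutativeMonoid.Mult (AbelianGroup.commutativeMonoid abelianGroup) public
    using (×-homo-+; ×-assocˡ; ×-homo-1; ×-distrib-+) renaming (_×_ to _·_)

  iter-⊕≡· : ∀ c w → iter c (w ⊕_) 0# ≡ c · w
  iter-⊕≡· zero    w = refl
  iter-⊕≡· (suc c) w = cong (w ⊕_) (iter-⊕≡· c w)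

  IsAdditive : (C → C) → Set
  IsAdditive f = ∀ v w → f (v ⊕ w) ≡ f v ⊕ f w

  ⊖-⊕ : ∀ v w → ⊖ (v ⊕ w) ≡ ⊖ v ⊕ ⊖ w
  ⊖-⊕ v w = sym (⁻¹-∙-comm v w)

  exchange : ∀ {x y a b} → x ⊕ a ≡ y ⊕ b → x ⊕ ⊖ y ≡ b ⊕ ⊖ a
  exchange {x} {y} {a} {b} x+a≡y+b = begin
    x ⊕ ⊖ y                        ≡⟨ cong (_⊕ ⊖ y) (x≈z//y x a (y ⊕ b) x+a≡y+b) ⟩
    (y ⊕ b) ⊕ ⊖ a ⊕ ⊖ y            ≡⟨ assoc (y ⊕ b) (⊖ a) (⊖ y) ⟩
    (y ⊕ b) ⊕ (⊖ a ⊕ ⊖ y)          ≡⟨ cong ((y ⊕ b) ⊕_) (comm (⊖ a) (⊖ y)) ⟩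
    (y ⊕ b) ⊕ (⊖ y ⊕ ⊖ a)          ≡⟨ interchange y b (⊖ y) (⊖ a) ⟩
    (y ⊕ ⊖ y) ⊕ (b ⊕ ⊖ a)          ≡⟨ cong (_⊕ (b ⊕ ⊖ a)) (inverseʳ y) ⟩
    0# ⊕ (b ⊕ ⊖ a)                 ≡⟨ identityˡ _ ⟩
    b ⊕ ⊖ a                        ∎

  cancel-middle : ∀ a b c → (a ⊕ ⊖ b) ⊕ (b ⊕ ⊖ c) ≡ a ⊕ ⊖ c
  cancel-middle a b c = begin
    (a ⊕ ⊖ b) ⊕ (b ⊕ ⊖ c)   ≡⟨ assoc a (⊖ b) _ ⟩
    a ⊕ (⊖ b ⊕ (b ⊕ ⊖ c))   ≡⟨ cong (a ⊕_) (sym (assoc (⊖ b) b (⊖ c))) ⟩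
    a ⊕ ((⊖ b ⊕ b) ⊕ ⊖ c)   ≡⟨ cong (λ z → a ⊕ (z ⊕ ⊖ c)) (inverseˡ b) ⟩
    a ⊕ (0# ⊕ ⊖ c)          ≡⟨ cong (a ⊕_) (identityˡ (⊖ c)) ⟩
    a ⊕ ⊖ c                 ∎

  module Additive {f : C → C} (f-⊕ : IsAdditive f) where

    f-0# : f 0# ≡ 0#
    f-0# = identityʳ-unique (f 0#) (f 0#) (trans (sym (f-⊕ 0# 0#)) (cong f (identityʳ 0#)))

    f-⊖ : ∀ w → f (⊖ w) ≡ ⊖ f w
    f-⊖ w = inverseʳ-unique (f w) (f (⊖ w))
      (trans (sym (f-⊕ w (⊖ w))) (trans (cong f (inverseʳ w)) f-0#))

    f-· : ∀ c w → f (c · w) ≡ c · f w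
    f-· zero    w = f-0#
    f-· (suc c) w = trans (f-⊕ w (c · w)) (cong (f w ⊕_) (f-· c w))

    iter-⊕ : ∀ L → IsAdditive (iter L f)
    iter-⊕ zero    v w = refl
    iter-⊕ (suc L) v w = trans (cong f (iter-⊕ L v w)) (f-⊕ _ _)

  ·-zeroʳ : ∀ c → c · 0# ≡ 0#
  ·-zeroʳ c = Additive.f-0# (λ v w → ×-distrib-+ v w c)

  module Difference {s : C → C} (s-⊕ : IsAdditive s) where

    Δ : C → C
    Δ w = s w ⊕ ⊖ w

    Δ-⊕ : IsAdditive Δ
    Δ-⊕ v w = trans (cong₂ _⊕_ (s-⊕ v w) (⊖-⊕ v w)) (interchange (s v) (s w) (⊖ v) (⊖ w))

    Δ⊕id : ∀ w → Δ w ⊕ w ≡ s w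
    Δ⊕id w = trans (assoc (s w) (⊖ w) w) (trans (cong (s w ⊕_) (inverseˡ w)) (identityʳ (s w)))

    Δ-natural : ∀ {g : C → C} → IsAdditive g →
                (∀ w → g (s w) ≡ s (g w)) → ∀ w → g (Δ w) ≡ Δ (g w)
    Δ-natural g-⊕ gs w = trans (g-⊕ _ _) (cong₂ _⊕_ (gs w) (Additive.f-⊖ g-⊕ w))

    N : ℕ → C → C
    N zero    w = 0#
    N (suc L) w = w ⊕ N L (s w)

    N-⊕ : ∀ L → IsAdditive (N L)
    N-⊕ zero    v w = sym (identityʳ 0#)
    N-⊕ (suc L) v w =
      trans (cong ((v ⊕ w) ⊕_) (trans (cong (N L) (s-⊕ v w)) (N-⊕ L (s v) (s w))))
            (interchange _ _ _ _)

    N-natural : ∀ {g : C → C} → IsAdditive g →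
                (∀ w → g (s w) ≡ s (g w)) → ∀ L w → g (N L w) ≡ N L (g w)
    N-natural g-⊕ gs zero    w = Additive.f-0# g-⊕
    N-natural g-⊕ gs (suc L) w =
      trans (g-⊕ _ _) (cong (_ ⊕_) (trans (N-natural g-⊕ gs L (s w)) (cong (N L) (gs w))))

    N-+ : ∀ a b w → N (a ℕ.+ b) w ≡ N a w ⊕ N b (iter a s w)
    N-+ zero    b w = sym (identityˡ _)
    N-+ (suc a) b w = begin
      w ⊕ N (a ℕ.+ b) (s w)                  ≡⟨ cong (w ⊕_) (N-+ a b (s w)) ⟩
      w ⊕ (N a (s w) ⊕ N b (iter a s (s w))) ≡⟨ cong (λ z → w ⊕ (N a (s w) ⊕ N b z)) (iter-suc a s w) ⟩
      w ⊕ (N a (s w) ⊕ N b (iter (suc a) s w)) ≡⟨ sym (assoc _ _ _) ⟩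
      N (suc a) w ⊕ N b (iter (suc a) s w)   ∎

    N-snoc : ∀ L w → N (suc L) w ≡ N L w ⊕ iter L s w
    N-snoc L w = begin
      N (suc L) w                        ≡⟨ cong (λ z → N z w) (ℕP.+-comm 1 L) ⟩
      N (L ℕ.+ 1) w                      ≡⟨ N-+ L 1 w ⟩
      N L w ⊕ (iter L s w ⊕ 0#)          ≡⟨ cong (N L w ⊕_) (identityʳ _) ⟩
      N L w ⊕ iter L s w                 ∎

    Δ-N : ∀ L w → Δ (N L w) ≡ iter L s w ⊕ ⊖ w
    Δ-N zero    w = trans (Additive.f-0# Δ-⊕) (sym (inverseʳ w))
    Δ-N (suc L) w = begin
      Δ (w ⊕ N L (s w))                         ≡⟨ Δ-⊕ w _ ⟩
      (s w ⊕ ⊖ w) ⊕ Δ (N L (s w))               ≡⟨ cong ((s w ⊕ ⊖ w) ⊕_) (Δ-N L (s w)) ⟩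
      (s w ⊕ ⊖ w) ⊕ (iter L s (s w) ⊕ ⊖ s w)    ≡⟨ comm _ _ ⟩
      (iter L s (s w) ⊕ ⊖ s w) ⊕ (s w ⊕ ⊖ w)    ≡⟨ cancel-middle _ (s w) w ⟩
      iter L s (s w) ⊕ ⊖ w                      ≡⟨ cong (_⊕ ⊖ w) (iter-suc L s w) ⟩
      iter (suc L) s w ⊕ ⊖ w                    ∎

    poly : ℕ → (ℕ → ℕ) → C → C
    poly zero    c w = 0#
    poly (suc L) c w = c 0 · w ⊕ poly L (c ∘ suc) (Δ w)

    poly-cong : ∀ L {c d : ℕ → ℕ} → (∀ i → c i ≡ d i) → ∀ w → poly L c w ≡ poly L d w
    poly-cong zero    c≗d w = refl
    poly-cong (suc L) c≗d w = cong₂ _⊕_ (cong (_· w) (c≗d 0)) (poly-cong L (c≗d ∘ suc) (Δ w))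

    poly-+ : ∀ L c d w → poly L (λ i → c i ℕ.+ d i) w ≡ poly L c w ⊕ poly L d w
    poly-+ zero    c d w = sym (identityʳ 0#)
    poly-+ (suc L) c d w =
      trans (cong₂ _⊕_ (×-homo-+ w (c 0) (d 0)) (poly-+ L (c ∘ suc) (d ∘ suc) (Δ w)))
            (interchange _ _ _ _)

    poly-⊕ : ∀ L c → IsAdditive (poly L c)
    poly-⊕ zero    c v w = sym (identityʳ 0#)
    poly-⊕ (suc L) c v w =
      trans (cong₂ _⊕_ (×-distrib-+ v w (c 0))
                       (trans (cong (poly L (c ∘ suc)) (Δ-⊕ v w)) (poly-⊕ L (c ∘ suc) (Δ v) (Δ w))))
            (interchange _ _ _ _)

    poly-natural : ∀ {g : C → C} → IsAdditive g →
                   (∀ w → g (Δ w) ≡ Δ (g w)) → ∀ L c w → g (poly L c w) ≡ poly L c (g w)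
    poly-natural g-⊕ gΔ zero    c w = Additive.f-0# g-⊕
    poly-natural g-⊕ gΔ (suc L) c w =
      trans (g-⊕ _ _) (cong₂ _⊕_ (Additive.f-· g-⊕ (c 0) w)
        (trans (poly-natural g-⊕ gΔ L (c ∘ suc) (Δ w)) (cong (poly L (c ∘ suc)) (gΔ w))))

    poly-snoc : ∀ L c w → poly (suc L) c w ≡ poly L c w ⊕ c L · iter L Δ w
    poly-snoc zero    c w = trans (identityʳ _) (sym (identityˡ _))
    poly-snoc (suc L) c w = begin
        c 0 · w ⊕ poly (suc L) (c ∘ suc) (Δ w)
      ≡⟨ cong (c 0 · w ⊕_) (poly-snoc L (c ∘ suc) (Δ w)) ⟩
        c 0 · w ⊕ (poly L (c ∘ suc) (Δ w) ⊕ c (suc L) · iter L Δ (Δ w))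
      ≡⟨ sym (assoc _ _ _) ⟩
        poly (suc L) c w ⊕ c (suc L) · iter L Δ (Δ w)
      ≡⟨ cong (λ z → poly (suc L) c w ⊕ c (suc L) · z) (iter-suc L Δ w) ⟩
        poly (suc L) c w ⊕ c (suc L) · iter (suc L) Δ w
      ∎

    poly-drop : ∀ L c w → c L ≡ 0 → poly (suc L) c w ≡ poly L c w
    poly-drop L c w cL≡0 =
      trans (poly-snoc L c w) (trans (cong (λ z → poly L c w ⊕ z · iter L Δ w) cL≡0) (identityʳ _))

    power-expansion : ∀ j w → iter j s w ≡ poly (suc j) (choose j) w
    power-expansion zero    w = sym (trans (identityʳ _) (×-homo-1 w))
    power-expansion (suc j) w = begin
        s (iter j s w)
      ≡⟨ cong s (power-expansion j w) ⟩
        s (poly (suc j) (choose j) w)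
      ≡⟨ poly-natural s-⊕ (Δ-natural s-⊕ (λ _ → refl)) (suc j) (choose j) w ⟩
        poly (suc j) (choose j) (s w)
      ≡⟨ cong (poly (suc j) (choose j)) (sym (Δ⊕id w)) ⟩
        poly (suc j) (choose j) (Δ w ⊕ w)
      ≡⟨ trans (poly-⊕ (suc j) (choose j) (Δ w) w) (comm _ _) ⟩
        poly (suc j) (choose j) w ⊕ poly (suc j) (choose j) (Δ w)
      ≡⟨ cong₂ _⊕_ (sym (poly-drop (suc j) (choose j) w (choose-> (ℕP.n<1+n j)))) (sym (identityˡ _)) ⟩
        poly (suc (suc j)) (choose j) w ⊕ poly (suc (suc j)) shifted w
      ≡⟨ sym (poly-+ (suc (suc j)) (choose j) shifted w) ⟩
        poly (suc (suc j)) (λ i → choose j i ℕ.+ shifted i) w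
      ≡⟨ poly-cong (suc (suc j)) pascal w ⟩
        poly (suc (suc j)) (choose (suc j)) w
      ∎
      where
      shifted : ℕ → ℕ
      shifted zero    = 0
      shifted (suc i) = choose j i

      pascal : ∀ i → choose j i ℕ.+ shifted i ≡ choose (suc j) i
      pascal zero    = refl
      pascal (suc i) = ℕP.+-comm (choose j (suc i)) (choose j i)

    -- Summing the binomial theorem (hockey-stick identity):
    -- 1 + s + ⋯ + s^(L-1) = Σ_{i<L} C(L,i+1) Δ^i.
    norm-expansion : ∀ L w → N L w ≡ poly L (λ i → choose L (suc i)) w
    norm-expansion zero    w = refl
    norm-expansion (suc L) w = begin
        N (suc L) w
      ≡⟨ N-snoc L w ⟩
        N L w ⊕ iter L s w
      ≡⟨ cong₂ _⊕_ (norm-expansion L w) (power-expansion L w) ⟩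
        poly L c w ⊕ poly (suc L) (choose L) w
      ≡⟨ cong (_⊕ poly (suc L) (choose L) w) (sym (poly-drop L c w (choose-> (ℕP.n<1+n L)))) ⟩
        poly (suc L) c w ⊕ poly (suc L) (choose L) w
      ≡⟨ sym (poly-+ (suc L) c (choose L) w) ⟩
        poly (suc L) (λ i → c i ℕ.+ choose L i) w
      ≡⟨ poly-cong (suc L) (λ i → ℕP.+-comm (choose L (suc i)) (choose L i)) w ⟩
        poly (suc L) (λ i → choose (suc L) (suc i)) w
      ∎
      where
      c : ℕ → ℕ
      c i = choose L (suc i)

  N-* : ∀ {s : C → C} (s-⊕ : IsAdditive s) c M w →
        Difference.N (Additive.iter-⊕ s-⊕ M) c (Difference.N s-⊕ M w) ≡ Difference.N s-⊕ (c ℕ.* M) w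
  N-* s-⊕ zero    M w = refl
  N-* {s} s-⊕ (suc c) M w = begin
      N M w ⊕ Nₜ c (iter M s (N M w))   ≡⟨ cong (λ z → N M w ⊕ Nₜ c z) (N-natural (Additive.iter-⊕ s-⊕ M) (iter-suc M s) M w) ⟩
      N M w ⊕ Nₜ c (N M (iter M s w))   ≡⟨ cong (N M w ⊕_) (N-* s-⊕ c M (iter M s w)) ⟩
      N M w ⊕ N (c ℕ.* M) (iter M s w)  ≡⟨ sym (N-+ M (c ℕ.* M) w) ⟩
      N (M ℕ.+ c ℕ.* M) w               ∎
    where
    open Difference s-⊕
    Nₜ = Difference.N (Additive.iter-⊕ s-⊕ M)

module ExponentP {C : Set} {_+_ : C → C → C} {0# : C} { -_ : C → C }
                 (isAbelianGroup : IsAbelianGroup _≡_ _+_ 0# -_) (P : ℕ)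
                 (p·≡0 : ∀ w → AbelianGroupFacts._·_ isAbelianGroup (suc P) w ≡ 0#) where

  open AbelianGroupFacts isAbelianGroup

  p : ℕ
  p = suc P

  multiple-of-p : ∀ c w → (c ℕ.* p) · w ≡ 0#
  multiple-of-p c w = trans (sym (×-assocˡ w c p)) (trans (cong (c ·_) (p·≡0 w)) (·-zeroʳ c))

  ·-% : ∀ c w → (c % p) · w ≡ c · w
  ·-% c w = sym (begin
    c · w                               ≡⟨ cong (_· w) (m≡m%n+[m/n]*n c p) ⟩
    (c % p ℕ.+ (c / p) ℕ.* p) · w       ≡⟨ ×-homo-+ w (c % p) _ ⟩
    (c % p) · w ⊕ ((c / p) ℕ.* p) · w   ≡⟨ cong ((c % p) · w ⊕_) (multiple-of-p (c / p) w) ⟩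
    (c % p) · w ⊕ 0#                    ≡⟨ identityʳ _ ⟩
    (c % p) · w                         ∎)

  ·-cong-mod : ∀ {c d} → c % p ≡ d % p → ∀ w → c · w ≡ d · w
  ·-cong-mod {c} {d} c≡d w = trans (sym (·-% c w)) (trans (cong (_· w) c≡d) (·-% d w))

  ⊖≡P· : ∀ w → ⊖ w ≡ P · w
  ⊖≡P· w = sym (inverseʳ-unique w (P · w) (p·≡0 w))

  ·-difference : ∀ c d w → c · w ⊕ ⊖ (d · w) ≡ (c ℕ.+ P ℕ.* d) · w
  ·-difference c d w = begin
    c · w ⊕ ⊖ (d · w)        ≡⟨ cong (c · w ⊕_) (trans (⊖≡P· (d · w)) (×-assocˡ w P d)) ⟩
    c · w ⊕ (P ℕ.* d) · w    ≡⟨ sym (×-homo-+ w c (P ℕ.* d)) ⟩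
    (c ℕ.+ P ℕ.* d) · w      ∎

  scalar-inverse : Prime p → ∀ c → c % p ≢ 0 → ∃ λ d → ∀ w → d · (c · w) ≡ w
  scalar-inverse p-prime c c≢0 with coprime-Bézout coprime
    where
    coprime : Coprime c p
    coprime {d} (d∣c , d∣p) with prime⇒irreducible p-prime d∣p
    ... | inj₁ d≡1 = d≡1
    ... | inj₂ refl = ⊥-elim (c≢0 (n∣m⇒m%n≡0 c p d∣c))
  ... | Bézout.+- x y eq = x , λ w → begin
      x · (c · w)              ≡⟨ ×-assocˡ w x c ⟩
      (x ℕ.* c) · w            ≡⟨ cong (_· w) (sym eq) ⟩
      w ⊕ (y ℕ.* p) · w        ≡⟨ cong (w ⊕_) (multiple-of-p y w) ⟩
      w ⊕ 0#                   ≡⟨ identityʳ w ⟩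
      w                        ∎
  ... | Bézout.-+ x y eq = P ℕ.* x , λ w → begin
      (P ℕ.* x) · (c · w)      ≡⟨ sym (×-assocˡ _ P x) ⟩
      P · (x · (c · w))        ≡⟨ cong (P ·_) (x·c·w≡⊖w w) ⟩
      P · ⊖ w                  ≡⟨ sym (⊖≡P· (⊖ w)) ⟩
      ⊖ ⊖ w                    ≡⟨ ⁻¹-involutive w ⟩
      w                        ∎
    where
    x·c·w≡⊖w : ∀ w → x · (c · w) ≡ ⊖ w
    x·c·w≡⊖w w = inverseʳ-unique w _ (begin
      w ⊕ x · (c · w)          ≡⟨ cong (w ⊕_) (×-assocˡ w x c) ⟩
      (1 ℕ.+ x ℕ.* c) · w      ≡⟨ cong (_· w) eq ⟩
      (y ℕ.* p) · w            ≡⟨ multiple-of-p y w ⟩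
      0#                       ∎)

  module _ {s : C → C} (s-⊕ : IsAdditive s) where
    open Difference s-⊕

    poly-vanish : ∀ L c w → (∀ i → i < L → c i % p ≡ 0) → poly L c w ≡ 0#
    poly-vanish zero    c w _   = refl
    poly-vanish (suc L) c w c≡0 = begin
      c 0 · w ⊕ poly L (c ∘ suc) (Δ w) ≡⟨ cong₂ _⊕_ (·-cong-mod {c 0} {0} (c≡0 0 (s≤s z≤n)) w)
                                            (poly-vanish L (c ∘ suc) (Δ w) (λ i i<L → c≡0 (suc i) (s≤s i<L))) ⟩
      0# ⊕ 0#                          ≡⟨ identityʳ 0# ⟩
      0#                               ∎

    -- In characteristic p:  (s - 1)^(p-1) = 1 + s + ⋯ + s^(p-1),
    -- since C(p, i+1) ≡ 0 for i < p - 1.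
    Δ^[p-1]≡N : Prime p → ∀ w → iter P Δ w ≡ N p w
    Δ^[p-1]≡N p-prime w = sym (begin
      N p w                              ≡⟨ norm-expansion p w ⟩
      poly p c w                         ≡⟨ poly-snoc P c w ⟩
      poly P c w ⊕ c P · iter P Δ w      ≡⟨ cong₂ _⊕_ (poly-vanish P c w c-vanish) (cong (_· iter P Δ w) (choose-diag p)) ⟩
      0# ⊕ 1 · iter P Δ w                ≡⟨ trans (identityˡ _) (×-homo-1 _) ⟩
      iter P Δ w                         ∎)
      where
      c : ℕ → ℕ
      c i = choose p (suc i)
      c-vanish : ∀ i → i < P → c i % p ≡ 0
      c-vanish i i<P = n∣m⇒m%n≡0 (c i) p (prime∣choose p-prime i<P)

  -- The inductive step from M = M'+1 to pM of the next lemma.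
  Δ^[pM-1]≡N : Prime p → ∀ M' →
    (∀ {s : C → C} (s-⊕ : IsAdditive s) w →
       iter M' (Difference.Δ s-⊕) w ≡ Difference.N s-⊕ (suc M') w) →
    ∀ {s : C → C} (s-⊕ : IsAdditive s) w →
    iter (M' ℕ.+ P ℕ.* suc M') (Difference.Δ s-⊕) w ≡ Difference.N s-⊕ (p ℕ.* suc M') w
  Δ^[pM-1]≡N p-prime M' IH {s} s-⊕ w = begin
      iter (M' ℕ.+ P ℕ.* M) Δ w   ≡⟨ cong (λ z → iter z Δ w) (ℕP.+-comm M' (P ℕ.* M)) ⟩
      iter (P ℕ.* M ℕ.+ M') Δ w   ≡⟨ iter-+ (P ℕ.* M) M' Δ w ⟩
      iter (P ℕ.* M) Δ (iter M' Δ w) ≡⟨ cong (iter (P ℕ.* M) Δ) (IH s-⊕ w) ⟩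
      iter (P ℕ.* M) Δ (N M w)    ≡⟨ iter-* P M Δ (N M w) ⟩
      iter P (iter M Δ) (N M w)   ≡⟨ iter-cong P Δ^M≡Δₜ (N M w) ⟩
      iter P Δₜ (N M w)           ≡⟨ Δ^[p-1]≡N t-⊕ p-prime (N M w) ⟩
      Nₜ p (N M w)                ≡⟨ N-* s-⊕ p M w ⟩
      N (p ℕ.* M) w               ∎
    where
    open Difference s-⊕
    M = suc M'
    t-⊕ = Additive.iter-⊕ s-⊕ M
    Δₜ = Difference.Δ t-⊕
    Nₜ = Difference.N t-⊕
    Δ^M≡Δₜ : ∀ u → iter M Δ u ≡ Δₜ u
    Δ^M≡Δₜ u = trans (cong Δ (IH s-⊕ u)) (Δ-N M u)

  Δ^[p^e-1]≡N : Prime p → ∀ e {s : C → C} (s-⊕ : IsAdditive s) w →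
                iter (p ^ e ∸ 1) (Difference.Δ s-⊕) w ≡ Difference.N s-⊕ (p ^ e) w
  Δ^[p^e-1]≡N p-prime zero    s-⊕ w = sym (identityʳ w)
  Δ^[p^e-1]≡N p-prime (suc e) s-⊕ w with p ^ e | ℕP.m^n>0 p e | Δ^[p^e-1]≡N p-prime e
  ... | suc M' | _ | IH = Δ^[pM-1]≡N p-prime M' IH s-⊕ w

lookup-init : ∀ {A : Set} {L} (v : Vec A (suc L)) i → lookup (init v) i ≡ lookup v (inject₁ i)
lookup-init (x ∷ [])     ()
lookup-init (x ∷ y ∷ ys) zero    = refl
lookup-init (x ∷ y ∷ ys) (suc i) = lookup-init (y ∷ ys) i

lookup-last : ∀ {A : Set} {L} (v : Vec A (suc L)) → last v ≡ lookup v (fromℕ L)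
lookup-last (x ∷ [])     = refl
lookup-last (x ∷ y ∷ ys) = lookup-last (y ∷ ys)

lookup-rotate-suc : ∀ {A : Set} {L} (v : Vec A (suc L)) i →
                    lookup (rotate v) (suc i) ≡ lookup v (inject₁ i)
lookup-rotate-suc (x ∷ xs) = lookup-init (x ∷ xs)

lookup-rotate-zero : ∀ {A : Set} {L} (v : Vec A (suc L)) → lookup (rotate v) zero ≡ lookup v (fromℕ L)
lookup-rotate-zero (x ∷ xs) = lookup-last (x ∷ xs)

rotate-fixed : ∀ {A : Set} {L} (v : Vec A (suc L)) → rotate v ≡ v → v ≡ replicate (suc L) (lookup v zero)
rotate-fixed (x ∷ xs) eq = cong (x ∷_) (init-fixed x xs (proj₂ (∷-injective eq)))
  where
  init-fixed : ∀ {L} x (xs : Vec _ L) → init (x ∷ xs) ≡ xs → xs ≡ replicate L x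
  init-fixed x []       _  = refl
  init-fixed x (y ∷ ys) eq with ∷-injective eq
  ... | refl , eq′ = cong (x ∷_) (init-fixed x ys eq′)

shift-invariant⇒constant : ∀ {A : Set} {L} (f : Fin (suc L) → A) →
                           (∀ i → f (suc i) ≡ f (inject₁ i)) → ∀ i → f i ≡ f zero
shift-invariant⇒constant {L = zero}  f shift zero    = refl
shift-invariant⇒constant {L = suc L} f shift zero    = refl
shift-invariant⇒constant {L = suc L} f shift (suc i) =
  trans (shift-invariant⇒constant (f ∘ suc) (shift ∘ suc) i) (shift zero)

sum-const : ∀ {L} (f : Fin L → ℕ) {c} → (∀ i → f i ≡ c) → sum f ≡ L ℕ.* c
sum-const {zero}  f f≡c = refl
sum-const {suc L} f f≡c = cong₂ ℕ._+_ (f≡c zero) (sum-const (f ∘ suc) (f≡c ∘ suc))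

module GroupRing (P : ℕ) where

  p : ℕ
  p = suc P

  +-%-absorb : ∀ a b → (a ℕ.+ b % p) % p ≡ (a ℕ.+ b) % p
  +-%-absorb a b = begin
    (a ℕ.+ b % p) % p            ≡⟨ %-distribˡ-+ a (b % p) p ⟩
    (a % p ℕ.+ b % p % p) % p    ≡⟨ cong (λ z → (a % p ℕ.+ z) % p) (m%n%n≡m%n b p) ⟩
    (a % p ℕ.+ b % p) % p        ≡⟨ sym (%-distribˡ-+ a b p) ⟩
    (a ℕ.+ b) % p                ∎

  toℕ-+p : ∀ (a b : Fin p) → toℕ (a +p b) ≡ (toℕ a ℕ.+ toℕ b) % p
  toℕ-+p a b = toℕ-fromℕ< _

  -- For distinct a, b ∈ F_p the scalar b + (p-1)a ≡ b - a is nonzero mod p.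
  difference-nonzero : ∀ (a b : Fin p) → a ≢ b → (toℕ b ℕ.+ P ℕ.* toℕ a) % p ≢ 0
  difference-nonzero a b a≢b b-a≡0 = a≢b (toℕ-injective (begin
      toℕ a                                         ≡⟨ sym (m<n⇒m%n≡m (toℕ<n a)) ⟩
      toℕ a % p                                     ≡⟨ sym (m%n%n≡m%n (toℕ a) p) ⟩
      (0 ℕ.+ toℕ a % p) % p                         ≡⟨ cong (λ z → (z ℕ.+ toℕ a % p) % p) (sym b-a≡0) ⟩
      ((toℕ b ℕ.+ P ℕ.* toℕ a) % p ℕ.+ toℕ a % p) % p ≡⟨ sym (%-distribˡ-+ (toℕ b ℕ.+ P ℕ.* toℕ a) (toℕ a) p) ⟩
      (toℕ b ℕ.+ P ℕ.* toℕ a ℕ.+ toℕ a) % p          ≡⟨ cong (_% p) (rearrange (toℕ b) (toℕ a)) ⟩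
      (toℕ b ℕ.+ toℕ a ℕ.* p) % p                    ≡⟨ [m+kn]%n≡m%n (toℕ b) (toℕ a) p ⟩
      toℕ b % p                                     ≡⟨ m<n⇒m%n≡m (toℕ<n b) ⟩
      toℕ b                                         ∎))
    where
    open +-*-Solver
    rearrange : ∀ x y → x ℕ.+ P ℕ.* y ℕ.+ y ≡ x ℕ.+ y ℕ.* p
    rearrange x y = solve 3 (λ x y P′ → x :+ P′ :* y :+ y := x :+ y :* (con 1 :+ P′)) refl x y P

  ε : ∀ {L} → Vec (Fin p) L → ℕ
  ε r = sum (λ i → toℕ (lookup r i))

  ε-rotate : ∀ {L} (r : Vec (Fin p) L) → ε (rotate r) ≡ ε r
  ε-rotate []                   = refl
  ε-rotate {suc L} r@(_ ∷ _) = begin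
      toℕ (lookup (rotate r) zero) ℕ.+ sum (λ i → toℕ (lookup (rotate r) (suc i)))
    ≡⟨ cong₂ ℕ._+_ (cong toℕ (lookup-rotate-zero r)) (sum-cong-≗ (cong toℕ ∘ lookup-rotate-suc r)) ⟩
      toℕ (lookup r (fromℕ L)) ℕ.+ sum (λ i → toℕ (lookup r (inject₁ i)))
    ≡⟨ ℕP.+-comm (toℕ (lookup r (fromℕ L))) _ ⟩
      sum (λ i → toℕ (lookup r (inject₁ i))) ℕ.+ toℕ (lookup r (fromℕ L))
    ≡⟨ sym (sum-init-last (λ i → toℕ (lookup r i))) ⟩
      ε r
    ∎

  rotSum : ∀ {L} → ℕ → Vec (Fin p) L → Fin L → ℕ
  rotSum zero    r i = 0
  rotSum (suc J) r i = toℕ (lookup r i) ℕ.+ rotSum J (rotate r) i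

  rotSum-snoc : ∀ {L} J (r : Vec (Fin p) L) i →
                rotSum (suc J) r i ≡ rotSum J r i ℕ.+ toℕ (lookup (iter J rotate r) i)
  rotSum-snoc zero    r i = ℕP.+-comm _ 0
  rotSum-snoc (suc J) r i = begin
      toℕ (lookup r i) ℕ.+ rotSum (suc J) (rotate r) i
    ≡⟨ cong (toℕ (lookup r i) ℕ.+_) (rotSum-snoc J (rotate r) i) ⟩
      toℕ (lookup r i) ℕ.+ (rotSum J (rotate r) i ℕ.+ toℕ (lookup (iter J rotate (rotate r)) i))
    ≡⟨ sym (ℕP.+-assoc (toℕ (lookup r i)) _ _) ⟩
      rotSum (suc J) r i ℕ.+ toℕ (lookup (iter J rotate (rotate r)) i)
    ≡⟨ cong (λ z → rotSum (suc J) r i ℕ.+ toℕ (lookup z i)) (iter-suc J rotate r) ⟩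
      rotSum (suc J) r i ℕ.+ toℕ (lookup (iter (suc J) rotate r) i)
    ∎

  rotSum-rotate : ∀ {L} J (r : Vec (Fin p) (suc L)) i →
                  rotSum J (rotate r) (suc i) ≡ rotSum J r (inject₁ i)
  rotSum-rotate zero    r i = refl
  rotSum-rotate (suc J) r i =
    cong₂ ℕ._+_ (cong toℕ (lookup-rotate-suc r i)) (rotSum-rotate J (rotate r) i)

  -- Every σ^j r has augmentation ε r, so the coordinates of rotSum J r
  -- add up to J·ε r.
  rotSum-total : ∀ {L} J (r : Vec (Fin p) L) → sum (rotSum J r) ≡ J ℕ.* ε r
  rotSum-total {L} zero r = sum-replicate-zero L
  rotSum-total (suc J) r = begin
      sum (λ i → toℕ (lookup r i) ℕ.+ rotSum J (rotate r) i)
    ≡⟨ ∑-distrib-+ (λ i → toℕ (lookup r i)) (rotSum J (rotate r)) ⟩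
      ε r ℕ.+ sum (rotSum J (rotate r))
    ≡⟨ cong (ε r ℕ.+_) (trans (rotSum-total J (rotate r)) (cong (J ℕ.*_) (ε-rotate r))) ⟩
      ε r ℕ.+ J ℕ.* ε r
    ∎

  -- If σ^L r = r (L the length of r), rotSum L r is invariant under
  -- shifting its coordinates, hence constant, hence equal to ε r everywhere.
  rotSum-periodic : ∀ {L} (r : Vec (Fin p) L) → iter L rotate r ≡ r → ∀ i → rotSum L r i ≡ ε r
  rotSum-periodic {suc L} r periodic i = trans (constant i)
    (ℕP.*-cancelˡ-≡ _ _ (suc L) (trans (sym (sum-const (rotSum (suc L) r) constant)) (rotSum-total (suc L) r)))
    where
    shift : ∀ i → rotSum (suc L) r (suc i) ≡ rotSum (suc L) r (inject₁ i)
    shift i = begin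
        toℕ (lookup r (suc i)) ℕ.+ rotSum L (rotate r) (suc i)
      ≡⟨ cong (toℕ (lookup r (suc i)) ℕ.+_) (rotSum-rotate L r i) ⟩
        toℕ (lookup r (suc i)) ℕ.+ rotSum L r (inject₁ i)
      ≡⟨ ℕP.+-comm (toℕ (lookup r (suc i))) _ ⟩
        rotSum L r (inject₁ i) ℕ.+ toℕ (lookup r (suc i))
      ≡⟨ cong (λ z → rotSum L r (inject₁ i) ℕ.+ toℕ (lookup z (suc i))) (sym periodic) ⟩
        rotSum L r (inject₁ i) ℕ.+ toℕ (lookup (rotate (iter L rotate r)) (suc i))
      ≡⟨ cong (λ z → rotSum L r (inject₁ i) ℕ.+ toℕ z) (lookup-rotate-suc (iter L rotate r) i) ⟩
        rotSum L r (inject₁ i) ℕ.+ toℕ (lookup (iter L rotate r) (inject₁ i))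
      ≡⟨ sym (rotSum-snoc L r (inject₁ i)) ⟩
        rotSum (suc L) r (inject₁ i)
      ∎

    constant : ∀ i → rotSum (suc L) r i ≡ rotSum (suc L) r zero
    constant = shift-invariant⇒constant (rotSum (suc L) r) shift

  normVec : ∀ {L} → ℕ → Vec (Fin p) L → Vec (Fin p) L
  normVec {L} zero    r = replicate L zero
  normVec     (suc J) r = zipWith _+p_ r (normVec J (rotate r))

  toℕ-normVec : ∀ {L} J (r : Vec (Fin p) L) i → toℕ (lookup (normVec J r) i) ≡ rotSum J r i % p
  toℕ-normVec zero    r i = cong toℕ (lookup-replicate i zero)
  toℕ-normVec (suc J) r i = begin
      toℕ (lookup (zipWith _+p_ r (normVec J (rotate r))) i)
    ≡⟨ cong toℕ (lookup-zipWith _+p_ i r _) ⟩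
      toℕ (lookup r i +p lookup (normVec J (rotate r)) i)
    ≡⟨ toℕ-+p (lookup r i) _ ⟩
      (toℕ (lookup r i) ℕ.+ toℕ (lookup (normVec J (rotate r)) i)) % p
    ≡⟨ cong (λ z → (toℕ (lookup r i) ℕ.+ z) % p) (toℕ-normVec J (rotate r) i) ⟩
      (toℕ (lookup r i) ℕ.+ rotSum J (rotate r) i % p) % p
    ≡⟨ +-%-absorb (toℕ (lookup r i)) _ ⟩
      rotSum (suc J) r i % p
    ∎

  norm-augmentation : ∀ {L} (r : Vec (Fin p) L) → iter L rotate r ≡ r →
                      ∀ i → toℕ (lookup (normVec L r) i) ≡ ε r % p
  norm-augmentation {L} r periodic i = trans (toℕ-normVec L r i) (cong (_% p) (rotSum-periodic r periodic i))

module GroupAlgebra {P n : ℕ} (W : FpGModule (suc P) n) where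

  open FpGModule W public hiding (_+_; -_)
  open AbelianGroupFacts isAbelianGroup public
  open ExponentP isAbelianGroup P (λ w → trans (sym (iter-⊕≡· (suc P) w)) (char-p w)) public
  open Difference σ-+ public
  open GroupRing P public using (ε; toℕ-+p; normVec; norm-augmentation; difference-nonzero)

  m : ℕ
  m = p ^ n

  Δ^[m-1]≡N : Prime p → ∀ w → iter (m ∸ 1) Δ w ≡ N m w
  Δ^[m-1]≡N p-prime = Δ^[p^e-1]≡N p-prime n σ-+

  -- σ - 1 is nilpotent:  (σ - 1)^m = (σ - 1) N = σ^m - 1 = 0.
  Δ-nilpotent : Prime p → ∀ w → iter m Δ w ≡ 0#
  Δ-nilpotent p-prime w with m | ℕP.m^n>0 p n | Δ^[m-1]≡N p-prime | σ-order w
  ... | suc m′ | _ | Δ^m′≡N | σ^m≡id = begin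
    Δ (iter m′ Δ w)            ≡⟨ cong Δ (Δ^m′≡N w) ⟩
    Δ (N (suc m′) w)           ≡⟨ Δ-N (suc m′) w ⟩
    iter (suc m′) σ w ⊕ ⊖ w    ≡⟨ cong (_⊕ ⊖ w) σ^m≡id ⟩
    w ⊕ ⊖ w                    ≡⟨ inverseʳ w ⟩
    0#                         ∎

  Δ^-σ : ∀ j w → iter j Δ (σ w) ≡ σ (iter j Δ w)
  Δ^-σ j w = sym (iter-natural σ (Δ-natural σ-+ (λ _ → refl)) j w)

  infixr 7 _⋆_
  _⋆_ : ∀ {L} → Vec (Fin p) L → Carrier → Carrier
  []      ⋆ w = 0#
  (c ∷ r) ⋆ w = toℕ c · w ⊕ r ⋆ σ w

  +p-· : ∀ (a b : Fin p) w → toℕ (a +p b) · w ≡ toℕ a · w ⊕ toℕ b · w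
  +p-· a b w = trans (cong (_· w) (toℕ-+p a b)) (trans (·-% (toℕ a ℕ.+ toℕ b) w) (×-homo-+ w (toℕ a) (toℕ b)))

  ⋆-+p : ∀ {L} (r r′ : Vec (Fin p) L) w → zipWith _+p_ r r′ ⋆ w ≡ r ⋆ w ⊕ r′ ⋆ w
  ⋆-+p []      []        w = sym (identityʳ 0#)
  ⋆-+p (a ∷ r) (b ∷ r′) w =
    trans (cong₂ _⊕_ (+p-· a b w) (⋆-+p r r′ (σ w))) (interchange _ _ _ _)

  ⋆-⊕ : ∀ {L} (r : Vec (Fin p) L) → IsAdditive (r ⋆_)
  ⋆-⊕ []      v w = sym (identityʳ 0#)
  ⋆-⊕ (a ∷ r) v w =
    trans (cong₂ _⊕_ (×-distrib-+ v w (toℕ a)) (trans (cong (r ⋆_) (σ-+ v w)) (⋆-⊕ r (σ v) (σ w))))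
          (interchange _ _ _ _)

  ⋆-natural : ∀ {g : Carrier → Carrier} → IsAdditive g →
              (∀ w → g (σ w) ≡ σ (g w)) → ∀ {L} (r : Vec (Fin p) L) w → g (r ⋆ w) ≡ r ⋆ g w
  ⋆-natural g-⊕ gσ []      w = Additive.f-0# g-⊕
  ⋆-natural g-⊕ gσ (a ∷ r) w = trans (g-⊕ _ _) (cong₂ _⊕_ (Additive.f-· g-⊕ (toℕ a) w)
    (trans (⋆-natural g-⊕ gσ r (σ w)) (cong (r ⋆_) (gσ w))))

  ⋆-snoc : ∀ {L} (r : Vec (Fin p) L) c w → (r ∷ʳ c) ⋆ w ≡ r ⋆ w ⊕ toℕ c · iter L σ w
  ⋆-snoc []      c w = trans (identityʳ _) (sym (identityˡ _))
  ⋆-snoc {suc L} (a ∷ r) c w = begin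
      toℕ a · w ⊕ (r ∷ʳ c) ⋆ σ w                        ≡⟨ cong (toℕ a · w ⊕_) (⋆-snoc r c (σ w)) ⟩
      toℕ a · w ⊕ (r ⋆ σ w ⊕ toℕ c · iter L σ (σ w))    ≡⟨ sym (assoc _ _ _) ⟩
      (a ∷ r) ⋆ w ⊕ toℕ c · iter L σ (σ w)              ≡⟨ cong (λ z → (a ∷ r) ⋆ w ⊕ toℕ c · z) (iter-suc L σ w) ⟩
      (a ∷ r) ⋆ w ⊕ toℕ c · iter (suc L) σ w            ∎

  ⋆-rotate : ∀ {L} → (∀ w → iter L σ w ≡ w) → (r : Vec (Fin p) L) → ∀ w → rotate r ⋆ w ≡ σ (r ⋆ w)
  ⋆-rotate σ^L≡id []            w = sym (Additive.f-0# σ-+)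
  ⋆-rotate {suc L} σ^L≡id r@(_ ∷ _) w = sym (begin
      σ (r ⋆ w)                                        ≡⟨ ⋆-natural σ-+ (λ _ → refl) r w ⟩
      r ⋆ σ w                                          ≡⟨ cong (_⋆ σ w) (proj₂ (proj₂ (initLast r))) ⟩
      (init r ∷ʳ last r) ⋆ σ w                         ≡⟨ ⋆-snoc (init r) (last r) (σ w) ⟩
      init r ⋆ σ w ⊕ toℕ (last r) · iter L σ (σ w)
        ≡⟨ cong (λ z → init r ⋆ σ w ⊕ toℕ (last r) · z) (trans (iter-suc L σ w) (σ^L≡id w)) ⟩
      init r ⋆ σ w ⊕ toℕ (last r) · w                  ≡⟨ comm _ _ ⟩
      rotate r ⋆ w                                     ∎)

  ⋆-replicate : ∀ L c w → replicate L c ⋆ w ≡ toℕ c · N L w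
  ⋆-replicate zero    c w = sym (·-zeroʳ (toℕ c))
  ⋆-replicate (suc L) c w =
    trans (cong (toℕ c · w ⊕_) (⋆-replicate L c (σ w))) (sym (×-distrib-+ w _ (toℕ c)))

  -- A σ-invariant element of F_p[G] (a multiple of the norm) kills every w with N w = 0.
  ⋆-invariant : ∀ {L} (r : Vec (Fin p) L) → rotate r ≡ r → ∀ {d} → N L d ≡ 0# → r ⋆ d ≡ 0#
  ⋆-invariant []            _        _     = refl
  ⋆-invariant {L} r@(_ ∷ _) σr≡r {d} Nd≡0 = begin
    r ⋆ d                        ≡⟨ cong (_⋆ d) (rotate-fixed r σr≡r) ⟩
    replicate L c ⋆ d            ≡⟨ ⋆-replicate L c d ⟩
    toℕ c · N L d                ≡⟨ cong (toℕ c ·_) Nd≡0 ⟩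
    toℕ c · 0#                   ≡⟨ ·-zeroʳ (toℕ c) ⟩
    0#                           ∎
    where c = lookup r zero

  module Submodule {V : Carrier → Set} (V-sub : IsSubmodule V) where
    open IsSubmodule V-sub public

    ·∈ : ∀ c {w} → V w → V (c · w)
    ·∈ zero    _  = 0∈
    ·∈ (suc c) w∈ = +∈ w∈ (·∈ c w∈)

    ⋆∈ : ∀ {L} (r : Vec (Fin p) L) {w} → V w → V (r ⋆ w)
    ⋆∈ []      _  = 0∈
    ⋆∈ (a ∷ r) w∈ = +∈ (·∈ (toℕ a) w∈) (⋆∈ r (σ∈ w∈))

    Δ^∈ : ∀ j {w} → V w → V (iter j Δ w)
    Δ^∈ zero    w∈ = w∈
    Δ^∈ (suc j) w∈ = +∈ (σ∈ (Δ^∈ j w∈)) (-∈ (Δ^∈ j w∈))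

    difference∈ : ∀ {x y a b} → V a → V b → x ⊕ a ≡ y ⊕ b → V (x ⊕ ⊖ y)
    difference∈ a∈ b∈ x+a≡y+b = subst V (sym (exchange x+a≡y+b)) (+∈ b∈ (-∈ a∈))

    ·∈⁻¹ : Prime p → ∀ c → c % p ≢ 0 → ∀ {w} → V (c · w) → V w
    ·∈⁻¹ p-prime c c≢0 {w} cw∈ with scalar-inverse p-prime c c≢0
    ... | d , d·c·w≡w = subst V (d·c·w≡w w) (·∈ d cw∈)

    cancel-scalar : Prime p → ∀ (a b : Fin p) → a ≢ b → ∀ {c v₁ v₂} → V v₁ → V v₂ →
                    toℕ b · c ⊕ v₁ ≡ toℕ a · c ⊕ v₂ → V c
    cancel-scalar p-prime a b a≢b {c} v₁∈ v₂∈ eq =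
      ·∈⁻¹ p-prime (toℕ b ℕ.+ P ℕ.* toℕ a) (difference-nonzero a b a≢b)
        (subst V (·-difference (toℕ b) (toℕ a) c) (difference∈ v₁∈ v₂∈ eq))

    -- If Δc ∈ V then σ acts trivially on c modulo V, so r ⋆ c ≡ ε(r)·c (mod V).
    ⋆-mod : ∀ {c} → V (Δ c) → ∀ {L} (r : Vec (Fin p) L) → ∃ λ v → V v × (r ⋆ c ≡ ε r · c ⊕ v)
    ⋆-mod Δc∈ []      = 0# , 0∈ , sym (identityʳ 0#)
    ⋆-mod {c} Δc∈ (a ∷ r) with ⋆-mod Δc∈ r
    ... | v , v∈ , r⋆c≡ = r ⋆ Δ c ⊕ v , +∈ (⋆∈ r Δc∈) v∈ , (begin
        toℕ a · c ⊕ r ⋆ σ c                          ≡⟨ cong (λ z → toℕ a · c ⊕ r ⋆ z) (sym (Δ⊕id c)) ⟩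
        toℕ a · c ⊕ r ⋆ (Δ c ⊕ c)                    ≡⟨ cong (toℕ a · c ⊕_) (⋆-⊕ r (Δ c) c) ⟩
        toℕ a · c ⊕ (r ⋆ Δ c ⊕ r ⋆ c)                ≡⟨ cong (λ z → toℕ a · c ⊕ (r ⋆ Δ c ⊕ z)) r⋆c≡ ⟩
        toℕ a · c ⊕ (r ⋆ Δ c ⊕ (ε r · c ⊕ v))        ≡⟨ cong (toℕ a · c ⊕_) (x∙yz≈y∙xz _ _ _) ⟩
        toℕ a · c ⊕ (ε r · c ⊕ (r ⋆ Δ c ⊕ v))        ≡⟨ sym (assoc _ _ _) ⟩
        toℕ a · c ⊕ ε r · c ⊕ (r ⋆ Δ c ⊕ v)          ≡⟨ cong (_⊕ (r ⋆ Δ c ⊕ v)) (sym (×-homo-+ c (toℕ a) (ε r))) ⟩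
        (toℕ a ℕ.+ ε r) · c ⊕ (r ⋆ Δ c ⊕ v)          ∎)

module FreeModule (P n k : ℕ) where
  open GroupRing P using (p; normVec)

  Fr : Set
  Fr = FpG^ p n k

  infixl 6 _+F_
  _+F_ : Fr → Fr → Fr
  _+F_ = addFree p n k

  σF : Fr → Fr
  σF = σFree p n k

  0F : Fr
  0F = replicate k (replicate (p ^ n) zero)

  0F+0F : 0F +F 0F ≡ 0F
  0F+0F = trans (zipWith-replicate (zipWith _+p_) _ _) (cong (replicate k) (zipWith-replicate _+p_ zero zero))

  infixr 7 _⊙_
  _⊙_ : ℕ → Fr → Fr
  c ⊙ x = iter c (x +F_) 0F

  -- σ - 1 (with -1 = p - 1) and the norms 1 + σ + ⋯ + σ^(L-1)
  ΔF : Fr → Fr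
  ΔF x = σF x +F P ⊙ x

  NF : ℕ → Fr → Fr
  NF zero    x = 0F
  NF (suc L) x = x +F NF L (σF x)

  lookup-NF : ∀ L x i → lookup (NF L x) i ≡ normVec L (lookup x i)
  lookup-NF zero    x i = lookup-replicate i _
  lookup-NF (suc L) x i = begin
      lookup (zipWith (zipWith _+p_) x (NF L (σF x))) i
    ≡⟨ lookup-zipWith (zipWith _+p_) i x _ ⟩
      zipWith _+p_ (lookup x i) (lookup (NF L (σF x)) i)
    ≡⟨ cong (zipWith _+p_ (lookup x i)) (trans (lookup-NF L (σF x) i) (cong (normVec L) (lookup-map i rotate x))) ⟩
      zipWith _+p_ (lookup x i) (normVec L (rotate (lookup x i)))
    ∎

module FreeHom {P n : ℕ} (W : FpGModule (suc P) n) (k : ℕ) where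
  open GroupAlgebra W public
  open FreeModule P n k public

  module Hom {h : Fr → Carrier} (h-+F : ∀ x y → h (x +F y) ≡ h x ⊕ h y)
             (h-σ : ∀ x → h (σF x) ≡ σ (h x)) where

    h-0F : h 0F ≡ 0#
    h-0F = identityʳ-unique (h 0F) (h 0F) (trans (sym (h-+F 0F 0F)) (cong h 0F+0F))

    h-⊙ : ∀ c x → h (c ⊙ x) ≡ c · h x
    h-⊙ zero    x = h-0F
    h-⊙ (suc c) x = trans (h-+F x _) (cong (h x ⊕_) (h-⊙ c x))

    h-ΔF : ∀ x → h (ΔF x) ≡ Δ (h x)
    h-ΔF x = trans (h-+F _ _) (cong₂ _⊕_ (h-σ x) (trans (h-⊙ P x) (sym (⊖≡P· (h x)))))

    h-NF : ∀ L x → h (NF L x) ≡ N L (h x)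
    h-NF zero    x = h-0F
    h-NF (suc L) x = trans (h-+F _ _) (cong (h x ⊕_) (trans (h-NF L (σF x)) (cong (N L) (h-σ x))))

-- Let φ : F_p[G]^k ≅ V ⊆ W and δ ∈ W with
-- (σ - 1)^(m-1) δ = 0, i.e. N δ = 0.  For a ∈ F_p^k the map
--   f_a(x) = φ(x) + Σ_i a_i (x_i ⋆ δ)
-- is an injective module map F_p[G]^k → W, so its image U_a is a free
-- submodule of rank k; if δ ∉ V, then U_a ⊆ U_b forces a = b.
-- (p = Q + 2, so that 1 ∈ F_p is available as a coefficient.)
module Construction {Q n k : ℕ} (p-prime : Prime (suc (suc Q))) (W : FpGModule (suc (suc Q)) n)
  {V : FpGModule.Carrier W → Set} (V-sub : FpGModule.IsSubmodule W V) (V≅free : IsoToFree W k V)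
  (δ : FpGModule.Carrier W)
  (Δ^[m-1]δ≡0 : iter (suc (suc Q) ^ n ∸ 1) (FpGModule.σ-1 W) δ ≡ FpGModule.0# W)
  where

  open FreeHom W k
  open Submodule V-sub

  P : ℕ
  P = suc Q

  φ : Fr → Carrier
  φ = proj₁ V≅free

  φ-+F : ∀ x y → φ (x +F y) ≡ φ x ⊕ φ y
  φ-+F = proj₁ (proj₂ V≅free)

  φ-σ : ∀ x → φ (σF x) ≡ σ (φ x)
  φ-σ = proj₁ (proj₂ (proj₂ V≅free))

  φ-injective : ∀ x y → φ x ≡ φ y → x ≡ y
  φ-injective = proj₁ (proj₂ (proj₂ (proj₂ V≅free)))

  φ∈V : ∀ x → V (φ x)
  φ∈V = proj₂ (proj₂ (proj₂ (proj₂ (proj₂ V≅free))))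

  module Φ = Hom φ-+F φ-σ

  Nδ≡0 : N m δ ≡ 0#
  Nδ≡0 = trans (sym (Δ^[m-1]≡N p-prime δ)) Δ^[m-1]δ≡0

  slot-periodic : ∀ y i → iter m rotate (lookup y i) ≡ lookup y i
  slot-periodic y i = begin
      iter m rotate (lookup y i)   ≡⟨ sym (iter-natural (λ x → lookup x i) (lookup-map i rotate) m y) ⟩
      lookup (iter m σF y) i       ≡⟨ cong (λ z → lookup z i) σF^m≡id ⟩
      lookup y i                   ∎
    where
    σF^m≡id : iter m σF y ≡ y
    σF^m≡id = φ-injective _ _ (trans (iter-natural φ φ-σ m y) (σ-order (φ y)))

  ι : Fin m
  ι = fromℕ< (ℕP.m^n>0 p n)

  augmentation-via-norm : ∀ y i → ε (lookup y i) % p ≡ toℕ (lookup (lookup (NF m y) i) ι)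
  augmentation-via-norm y i = sym (begin
      toℕ (lookup (lookup (NF m y) i) ι)        ≡⟨ cong (λ z → toℕ (lookup z ι)) (lookup-NF m y i) ⟩
      toℕ (lookup (normVec m (lookup y i)) ι)   ≡⟨ norm-augmentation (lookup y i) (slot-periodic y i) ι ⟩
      ε (lookup y i) % p                        ∎)

  ΔF-kernel : ∀ y → ΔF y ≡ 0F → σF y ≡ y
  ΔF-kernel y ΔFy≡0 = φ-injective _ _ (trans (φ-σ y)
    (x∙y⁻¹≈ε⇒x≈y (σ (φ y)) (φ y) (trans (sym (Φ.h-ΔF y)) (trans (cong φ ΔFy≡0) Φ.h-0F))))

  -- ψ d a x = Σ_i a_i · (x_i ⋆ d): the module map F_p[G]^k → W sending
  -- the i-th basis vector to a_i d.
  ψ : ∀ {K} → Carrier → Vec (Fin p) K → Vec (FpG p n) K → Carrier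
  ψ d []       []       = 0#
  ψ d (a ∷ as) (x ∷ xs) = toℕ a · (x ⋆ d) ⊕ ψ d as xs

  ψ-+F : ∀ {K} d (a : Vec (Fin p) K) x y → ψ d a (zipWith (zipWith _+p_) x y) ≡ ψ d a x ⊕ ψ d a y
  ψ-+F d []       []       []       = sym (identityʳ 0#)
  ψ-+F d (a ∷ as) (x ∷ xs) (y ∷ ys) = trans
    (cong₂ _⊕_ (trans (cong (toℕ a ·_) (⋆-+p x y d)) (×-distrib-+ _ _ (toℕ a))) (ψ-+F d as xs ys))
    (interchange _ _ _ _)

  ψ-σF : ∀ {K} d (a : Vec (Fin p) K) x → ψ d a (map rotate x) ≡ σ (ψ d a x)
  ψ-σF d []       []       = sym (Additive.f-0# σ-+)
  ψ-σF d (a ∷ as) (x ∷ xs) = trans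
    (cong₂ _⊕_ (trans (cong (toℕ a ·_) (⋆-rotate σ-order x d)) (sym (Additive.f-· σ-+ (toℕ a) _))) (ψ-σF d as xs))
    (sym (σ-+ _ _))

  ψ-natural : ∀ {g : Carrier → Carrier} → IsAdditive g →
              (∀ w → g (σ w) ≡ σ (g w)) → ∀ {K} d (a : Vec (Fin p) K) x → g (ψ d a x) ≡ ψ (g d) a x
  ψ-natural g-⊕ gσ d []       []       = Additive.f-0# g-⊕
  ψ-natural g-⊕ gσ d (a ∷ as) (x ∷ xs) = trans (g-⊕ _ _) (cong₂ _⊕_
    (trans (Additive.f-· g-⊕ (toℕ a) _) (cong (toℕ a ·_) (⋆-natural g-⊕ gσ x d)))
    (ψ-natural g-⊕ gσ d as xs))

  ψ-zero : ∀ {K} (a : Vec (Fin p) K) x → ψ 0# a x ≡ 0#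
  ψ-zero []       []       = refl
  ψ-zero (a ∷ as) (x ∷ xs) = trans
    (cong₂ _⊕_ (trans (cong (toℕ a ·_) (Additive.f-0# (⋆-⊕ x))) (·-zeroʳ (toℕ a))) (ψ-zero as xs))
    (identityʳ 0#)

  N-ψ : ∀ {K} (a : Vec (Fin p) K) x → N m (ψ δ a x) ≡ 0#
  N-ψ a x = trans (ψ-natural (N-⊕ m) (λ w → sym (N-natural σ-+ (λ _ → refl) m w)) δ a x)
                  (trans (cong (λ d → ψ d a x) Nδ≡0) (ψ-zero a x))

  ψ-invariant : ∀ {K d} → N m d ≡ 0# → (a : Vec (Fin p) K) (y : Vec (FpG p n) K) → map rotate y ≡ y → ψ d a y ≡ 0#
  ψ-invariant Nd≡0 []       []       _    = refl
  ψ-invariant {d = d} Nd≡0 (a ∷ as) (y ∷ ys) σy≡y with ∷-injective σy≡y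
  ... | σy₀≡y₀ , σys≡ys = begin
    toℕ a · (y ⋆ d) ⊕ ψ d as ys   ≡⟨ cong₂ _⊕_ (trans (cong (toℕ a ·_) (⋆-invariant y σy₀≡y₀ Nd≡0)) (·-zeroʳ (toℕ a)))
                                               (ψ-invariant Nd≡0 as ys σys≡ys) ⟩
    0# ⊕ 0#                        ≡⟨ identityʳ 0# ⟩
    0#                             ∎

  -- aug b x c = Σ_i b_i · (ε(x_i) · c), the value of ψ_c(x) modulo V when σ
  -- fixes c modulo V.
  aug : ∀ {K} → Vec (Fin p) K → Vec (FpG p n) K → Carrier → Carrier
  aug []       []       c = 0#
  aug (b ∷ bs) (x ∷ xs) c = toℕ b · (ε x · c) ⊕ aug bs xs c

  ψ-mod : ∀ {c} → V (Δ c) → ∀ {K} (b : Vec (Fin p) K) x → ∃ λ v → V v × (ψ c b x ≡ aug b x c ⊕ v)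
  ψ-mod Δc∈ []       []       = 0# , 0∈ , sym (identityʳ 0#)
  ψ-mod {c} Δc∈ (b ∷ bs) (x ∷ xs) with ⋆-mod Δc∈ x | ψ-mod Δc∈ bs xs
  ... | v₁ , v₁∈ , x⋆c≡ | v₂ , v₂∈ , ψ≡ = toℕ b · v₁ ⊕ v₂ , +∈ (·∈ (toℕ b) v₁∈) v₂∈ , (begin
      toℕ b · (x ⋆ c) ⊕ ψ c bs xs
        ≡⟨ cong₂ _⊕_ (trans (cong (toℕ b ·_) x⋆c≡) (×-distrib-+ _ _ (toℕ b))) ψ≡ ⟩
      (toℕ b · (ε x · c) ⊕ toℕ b · v₁) ⊕ (aug bs xs c ⊕ v₂) ≡⟨ interchange _ _ _ _ ⟩
      aug (b ∷ bs) (x ∷ xs) c ⊕ (toℕ b · v₁ ⊕ v₂)          ∎)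

  aug-cong : ∀ {K} (b : Vec (Fin p) K) {x y} → (∀ i → ε (lookup x i) % p ≡ ε (lookup y i) % p) →
             ∀ c → aug b x c ≡ aug b y c
  aug-cong []       {[]}     {[]}     _    c = refl
  aug-cong (b ∷ bs) {x ∷ xs} {y ∷ ys} same c =
    cong₂ _⊕_ (cong (toℕ b ·_) (·-cong-mod {ε x} {ε y} (same zero) c)) (aug-cong bs (same ∘ suc) c)

  zeroVec : FpG p n
  zeroVec = replicate m zero

  unitVec : ∀ L → Vec (Fin p) L
  unitVec zero    = []
  unitVec (suc L) = suc zero ∷ replicate L zero

  ε-zeroVec : ∀ L → ε (replicate L zero) ≡ 0
  ε-zeroVec zero    = refl
  ε-zeroVec (suc L) = ε-zeroVec L

  ε-unitVec : ∀ {L} → 0 < L → ε (unitVec L) ≡ 1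
  ε-unitVec {suc L} _ = cong suc (ε-zeroVec L)

  basis : ∀ {K} → Fin K → Vec (FpG p n) K
  basis {suc K} zero    = unitVec m ∷ replicate K zeroVec
  basis         (suc l) = zeroVec ∷ basis l

  aug-zero : ∀ {K} (b : Vec (Fin p) K) c → aug b (replicate K zeroVec) c ≡ 0#
  aug-zero []       c = refl
  aug-zero (b ∷ bs) c = trans (cong₂ _⊕_ zero-term (aug-zero bs c)) (identityʳ 0#)
    where
    zero-term : toℕ b · (ε zeroVec · c) ≡ 0#
    zero-term = trans (cong (λ e → toℕ b · (e · c)) (ε-zeroVec m)) (·-zeroʳ (toℕ b))

  aug-basis : ∀ {K} (b : Vec (Fin p) K) l c → aug b (basis l) c ≡ toℕ (lookup b l) · c
  aug-basis (b ∷ bs) zero c = begin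
      toℕ b · (ε (unitVec m) · c) ⊕ aug bs (replicate _ zeroVec) c
        ≡⟨ cong₂ _⊕_ (cong (λ e → toℕ b · (e · c)) (ε-unitVec (ℕP.m^n>0 p n))) (aug-zero bs c) ⟩
      toℕ b · (1 · c) ⊕ 0#                                          ≡⟨ trans (identityʳ _) (cong (toℕ b ·_) (×-homo-1 c)) ⟩
      toℕ b · c                                                     ∎
  aug-basis (b ∷ bs) (suc l) c = begin
      toℕ b · (ε zeroVec · c) ⊕ aug bs (basis l) c
        ≡⟨ cong₂ _⊕_ (cong (λ e → toℕ b · (e · c)) (ε-zeroVec m)) (aug-basis bs l c) ⟩
      toℕ b · 0# ⊕ toℕ (lookup bs l) · c              ≡⟨ trans (cong (_⊕ _) (·-zeroʳ (toℕ b))) (identityˡ _) ⟩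
      toℕ (lookup bs l) · c                           ∎

  module Family (a : Vec (Fin p) k) where

    f : Fr → Carrier
    f x = φ x ⊕ ψ δ a x

    f-+F : ∀ x y → f (x +F y) ≡ f x ⊕ f y
    f-+F x y = trans (cong₂ _⊕_ (φ-+F x y) (ψ-+F δ a x y)) (interchange _ _ _ _)

    f-σ : ∀ x → f (σF x) ≡ σ (f x)
    f-σ x = trans (cong₂ _⊕_ (φ-σ x) (ψ-σF δ a x)) (sym (σ-+ _ _))

    module F = Hom f-+F f-σ

    N-f : ∀ y → N m (f y) ≡ φ (NF m y)
    N-f y = begin
      N m (φ y ⊕ ψ δ a y)        ≡⟨ N-⊕ m _ _ ⟩
      N m (φ y) ⊕ N m (ψ δ a y)  ≡⟨ cong₂ _⊕_ (sym (Φ.h-NF m y)) (N-ψ a y) ⟩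
      φ (NF m y) ⊕ 0#            ≡⟨ identityʳ _ ⟩
      φ (NF m y)                 ∎

    f-mod : ∀ j → V (iter (suc j) Δ δ) → ∀ y →
            ∃ λ v → V v × (iter j Δ (f y) ≡ aug a y (iter j Δ δ) ⊕ v)
    f-mod j Δc∈ y with ψ-mod Δc∈ a y
    ... | v , v∈ , ψ≡ = iter j Δ (φ y) ⊕ v , +∈ (Δ^∈ j (φ∈V y)) v∈ , (begin
        iter j Δ (φ y ⊕ ψ δ a y)            ≡⟨ Additive.iter-⊕ Δ-⊕ j _ _ ⟩
        iter j Δ (φ y) ⊕ iter j Δ (ψ δ a y)
          ≡⟨ cong (iter j Δ (φ y) ⊕_) (ψ-natural (Additive.iter-⊕ Δ-⊕ j) (Δ^-σ j) δ a y) ⟩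
        iter j Δ (φ y) ⊕ ψ c a y            ≡⟨ cong (iter j Δ (φ y) ⊕_) ψ≡ ⟩
        iter j Δ (φ y) ⊕ (aug a y c ⊕ v)    ≡⟨ x∙yz≈y∙xz _ _ _ ⟩
        aug a y c ⊕ (iter j Δ (φ y) ⊕ v)    ∎)
      where
      c = iter j Δ δ

    -- f has trivial kernel: if f z = 0, descend from (σ-1)^m z = 0 to z = 0,
    -- since an element y with (σ-1)y = 0 is σ-fixed, so ψ_δ(y) = 0 and
    -- φ(y) = f(y) = 0.
    kernel : ∀ z → f z ≡ 0# → z ≡ 0F
    kernel z fz≡0 = descend step m ΔF^m-z≡0
      where
      ΔF^m-z≡0 : iter m ΔF z ≡ 0F
      ΔF^m-z≡0 = φ-injective _ _
        (trans (iter-natural φ Φ.h-ΔF m z) (trans (Δ-nilpotent p-prime (φ z)) (sym Φ.h-0F)))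

      step : ∀ j → iter (suc j) ΔF z ≡ 0F → iter j ΔF z ≡ 0F
      step j ΔFy≡0 = φ-injective y 0F (trans φy≡0 (sym Φ.h-0F))
        where
        y = iter j ΔF z
        fy≡0 : f y ≡ 0#
        fy≡0 = trans (iter-natural f F.h-ΔF j z)
                     (trans (cong (iter j Δ) fz≡0) (Additive.f-0# (Additive.iter-⊕ Δ-⊕ j)))
        φy≡0 : φ y ≡ 0#
        φy≡0 = begin
          φ y              ≡⟨ sym (identityʳ _) ⟩
          φ y ⊕ 0#         ≡⟨ cong (φ y ⊕_) (sym (ψ-invariant Nδ≡0 a y (ΔF-kernel y ΔFy≡0))) ⟩
          f y              ≡⟨ fy≡0 ⟩
          0#               ∎

    -- Injectivity, applying the kernel lemma to x - y = x + (p-1) y.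
    injective : ∀ x y → f x ≡ f y → x ≡ y
    injective x y fx≡fy = φ-injective x y (x∙y⁻¹≈ε⇒x≈y (φ x) (φ y) (begin
        φ x ⊕ ⊖ φ y       ≡⟨ cong (φ x ⊕_) (⊖≡P· (φ y)) ⟩
        φ x ⊕ P · φ y     ≡⟨ sym (trans (φ-+F x _) (cong (φ x ⊕_) (Φ.h-⊙ P y))) ⟩
        φ (x +F P ⊙ y)   ≡⟨ cong φ (kernel _ f[x-y]≡0) ⟩
        φ 0F             ≡⟨ Φ.h-0F ⟩
        0#               ∎))
      where
      f[x-y]≡0 : f (x +F P ⊙ y) ≡ 0#
      f[x-y]≡0 = begin
        f (x +F P ⊙ y)    ≡⟨ f-+F x _ ⟩
        f x ⊕ f (P ⊙ y)   ≡⟨ cong₂ _⊕_ fx≡fy (trans (F.h-⊙ P y) (sym (⊖≡P· (f y)))) ⟩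
        f y ⊕ ⊖ f y       ≡⟨ inverseʳ (f y) ⟩
        0#                ∎

    U : Carrier → Set
    U w = ∃ λ x → f x ≡ w

    U-sub : IsSubmodule U
    U-sub = record
      { 0∈ = 0F , F.h-0F
      ; +∈ = λ { (x , refl) (y , refl) → x +F y , f-+F x y }
      ; -∈ = λ { (x , refl) → P ⊙ x , trans (F.h-⊙ P x) (sym (⊖≡P· (f x))) }
      ; σ∈ = λ { (x , refl) → σF x , f-σ x }
      }

    U≅free : IsoToFree W k U
    U≅free = f , f-+F , f-σ , injective , (λ _ w∈U → w∈U) , (λ x → x , refl)

  same-augmentation : ∀ {x y} → NF m x ≡ NF m y → ∀ i → ε (lookup x i) % p ≡ ε (lookup y i) % p
  same-augmentation {x} {y} Nx≡Ny i = trans (augmentation-via-norm x i)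
    (trans (cong (λ z → toℕ (lookup (lookup z i) ι)) Nx≡Ny) (sym (augmentation-via-norm y i)))

  -- Let f_b(x) = f_a(e_l) with a_l ≠ b_l.
  -- Applying N shows that x and e_l have the same slot augmentations, so for
  -- c = (σ-1)^j δ with (σ-1)c ∈ V, (σ-1)^j of the equation reads b_l c ≡ a_l c
  -- modulo V; hence c ∈ V.
  descent-step : ∀ a b l x → lookup a l ≢ lookup b l → Family.f b x ≡ Family.f a (basis l) →
                 ∀ j → V (iter (suc j) Δ δ) → V (iter j Δ δ)
  descent-step a b l x aₗ≢bₗ fb-x≡fa-u j Δc∈
    with Family.f-mod b j Δc∈ x | Family.f-mod a j Δc∈ (basis l)
  ... | v₁ , v₁∈ , eq₁ | v₂ , v₂∈ , eq₂ = cancel-scalar p-prime (lookup a l) (lookup b l) aₗ≢bₗ v₁∈ v₂∈ (begin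
      toℕ (lookup b l) · c ⊕ v₁
        ≡⟨ cong (_⊕ v₁) (sym (trans (aug-cong b (same-augmentation Nx≡Nu) c) (aug-basis b l c))) ⟩
      aug b x c ⊕ v₁              ≡⟨ sym eq₁ ⟩
      iter j Δ (Family.f b x)     ≡⟨ cong (iter j Δ) fb-x≡fa-u ⟩
      iter j Δ (Family.f a u)     ≡⟨ eq₂ ⟩
      aug a u c ⊕ v₂              ≡⟨ cong (_⊕ v₂) (aug-basis a l c) ⟩
      toℕ (lookup a l) · c ⊕ v₂   ∎)
    where
    u = basis l
    c = iter j Δ δ
    Nx≡Nu : NF m x ≡ NF m u
    Nx≡Nu = φ-injective _ _ (trans (sym (Family.N-f b x)) (trans (cong (N m) fb-x≡fa-u) (Family.N-f a u)))

  -- If δ ∉ V, then U_a ⊆ U_b implies a = b: descend from (σ-1)^(m-1) δ = 0 ∈ V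
  -- to δ ∈ V.
  distinct : ¬ V δ → ∀ a b l → lookup a l ≢ lookup b l → ¬ (∀ w → Family.U a w → Family.U b w)
  distinct δ∉V a b l aₗ≢bₗ Ua⊆Ub with Ua⊆Ub (Family.f a (basis l)) (basis l , refl)
  ... | x , fb-x≡fa-u =
    δ∉V (descend (descent-step a b l x aₗ≢bₗ fb-x≡fa-u) (m ∸ 1) (subst V (sym Δ^[m-1]δ≡0) 0∈))

digits : ∀ {q} k → Fin (q ^ k) → Vec (Fin q) k
digits {q} k i = tabulate (finToFun {q} {k} i)

funToFin-cong : ∀ {m n} {f g : Fin m → Fin n} → (∀ i → f i ≡ g i) → funToFin f ≡ funToFin g
funToFin-cong {zero}  _   = refl
funToFin-cong {suc m} f≗g = cong₂ combine (f≗g zero) (funToFin-cong (f≗g ∘ suc))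

digits-differ : ∀ {q} k (i j : Fin (q ^ k)) → i ≢ j → ∃ λ l → lookup (digits k i) l ≢ lookup (digits k j) l
digits-differ {q} k i j i≢j with ¬∀⟶∃¬ k _ (λ l → finToFun {q} {k} i l ≟ finToFun j l) (i≢j ∘ same-digits)
  where
  same-digits : (∀ l → finToFun {q} {k} i l ≡ finToFun j l) → i ≡ j
  same-digits same =
    trans (sym (funToFin-finToFin {k} {q} i)) (trans (funToFin-cong same) (funToFin-finToFin {k} {q} j))
... | l , differ = l , λ eq → differ (trans (sym (lookup∘tabulate _ l)) (trans eq (lookup∘tabulate _ l)))

-- Proposition 4.2: the U_a, indexed by the digits of i : Fin (p^k), are p^k
-- distinct free submodules of rank k.
proposition4p2 : (p n k : ℕ) → Prime p → 1 ≤ n → (p ≡ 2 → 2 ≤ n) → 1 ≤ k →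
    (W : FpGModule p n) →
    let open FpGModule W in
    (V : Carrier → Set) → IsSubmodule V → IsoToFree W k V →
    (∃ λ w → ¬ V w) →
    (δ : Carrier) → iter (p ^ n ∸ 1) σ-1 δ ≡ 0# → ¬ V δ →
    Σ (Fin (p ^ k) → Carrier → Set) λ U →
      (∀ i → IsSubmodule (U i) × IsoToFree W k (U i)) ×
      (∀ i j → i ≢ j → ¬ SameSubset (U i) (U j))
proposition4p2 zero          _ _ p-prime = ⊥-elim (¬prime[0] p-prime)
proposition4p2 (suc zero)    _ _ p-prime = ⊥-elim (¬prime[1] p-prime)
proposition4p2 (suc (suc Q)) n k p-prime _ _ _ W V V-sub V≅free _ δ Δ^[m-1]δ≡0 δ∉V =
  U , (λ i → Family.U-sub (digits k i) , Family.U≅free (digits k i)) , U-distinct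
  where
  open Construction p-prime W V-sub V≅free δ Δ^[m-1]δ≡0

  U : Fin (suc (suc Q) ^ k) → FpGModule.Carrier W → Set
  U i = Family.U (digits k i)

  U-distinct : ∀ i j → i ≢ j → ¬ FpGModule.SameSubset W (U i) (U j)
  U-distinct i j i≢j (Ui⊆Uj , _) with digits-differ k i j i≢j
  ... | l , differ = distinct δ∉V (digits k i) (digits k j) l differ Ui⊆Uj
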